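{- After the decomposition algorithm terminates, each refined segment is relevant to at most one canonical refined segment.
   Context: Setting: haplotypes $S_1,\dots,S_h$ of length $m$; prefix array $\mathrm{PA}$ ($h\times m$, column $1$ is $1,\dots,h$, column $j>1$ sorts indices by co-lexicographic order of $S_i[1..j-1]$, ties broken stably); PBWT with $\mathrm{col}_j(\mathrm{PBWT})[x]=S_{\mathrm{col}_j(\mathrm{PA})[x]}[j]$; $(x,j)$ is a run-top if $x=1$ or $\mathrm{col}_j(\mathrm{PBWT})[x]\ne\mathrm{col}_j(\mathrm{PBWT})[x-1]$. For $\mathrm{col}_j(\mathrm{PA})[x]=i$: $\phi_j(i)=0$ if $x=1$, else $\phi_j(i)=\mathrm{col}_j(\mathrm{PA})[x-1]$. Haplotype intervals of $S_i$: with $b_1<\dots<b_k=m$ the set of $m$ and all columns $j$ such that some run-top $(x,j)$ has $\mathrm{col}_j(\mathrm{PA})[x]=i$, they are $[1,b_1],[b_1+1,b_2],\dots,[b_{k-1}+1,b_k]$. Two intervals overlap if they share an integer. Decomposition algorithm with integer parameter $d>1$: initially, for each $c$, $L_c$ is the linked list of haplotype intervals of $S_c$ in increasing order and $\mathrm{RS}[c]$ is empty. For $j=1,\dots,m$ and, within each $j$, for $i=1,\dots,h$: let $c=\mathrm{col}_j(\mathrm{PA})[i]$ and let $[b_c,e_c]$ be the first interval of $L_c$. If $j=e_c$, remove $[b_c,e_c]$ from $L_c$ and append it to the tail of $\mathrm{RS}[c]$ (Passive Split). Otherwise, if $i>1$ and $[b_c,j]$ overlaps exactly $d$ refined segments currently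 in $\mathrm{RS}[c']$, where $c'=\mathrm{col}_j(\mathrm{PA})[i-1]$, append $[b_c,j]$ to $\mathrm{RS}[c]$ and replace the head $[b_c,e_c]$ of $L_c$ by $[j+1,e_c]$ (Active Split). Intervals in the lists $\mathrm{RS}[\cdot]$ are called refined segments. A refined segment is canonical if it was produced by an Active Split step, and non-canonical otherwise. For a canonical refined segment $[b_c,e_c]\in\mathrm{RS}[c]$, with $c'=\phi_{e_c}(c)$, its canonical set is the set of refined segments of (the final) $\mathrm{RS}[c']$ that overlap $[b_c,e_c]$; a refined segment is relevant to the canonical refined segment $[b_c,e_c]$ if it belongs to the canonical set of $[b_c,e_c]$. -}

module Defs where

open import Data.Nat using (ℕ; zero; suc; _+_; _∸_; _<_; _≤ᵇ_; _<ᵇ_; _≡ᵇ_)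
open import Data.Bool using (Bool; true; false; _∧_; _∨_; not; if_then_else_; T)
open import Data.List using (List; []; _∷_; length; lookup; _++_; [_]; foldr; foldl)
open import Data.Bool.ListAction using (any)
open import Data.Fin using (Fin)
open import Data.Product using (Σ; _×_; _,_; proj₁; proj₂)
open import Relation.Binary.PropositionalEquality using (_≡_)

-- A closed integer interval [b , e].
Interval : Set
Interval = ℕ × ℕ

overlapᵇ : Interval → Interval → Bool
overlapᵇ (b₁ , e₁) (b₂ , e₂) = (b₁ ≤ᵇ e₁) ∧ (b₂ ≤ᵇ e₂) ∧ (b₁ ≤ᵇ e₂) ∧ (b₂ ≤ᵇ e₁)

range : ℕ → ℕ → List ℕ
range a zero    = []
range a (suc n) = a ∷ range (suc a) n

oneTo : ℕ → List ℕ
oneTo n = range 1 n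

-- 1-based lookup (default 0 when out of range)
nth : List ℕ → ℕ → ℕ
nth []       _             = 0
nth (x ∷ xs) zero          = 0
nth (x ∷ xs) (suc zero)    = x
nth (x ∷ xs) (suc (suc k)) = nth xs (suc k)

-- 1-based position of the first occurrence of i (0 if absent)
posOf : ℕ → List ℕ → ℕ
posOf i []       = 0
posOf i (x ∷ xs) = if x ≡ᵇ i then 1 else (if posOf i xs ≡ᵇ 0 then 0 else suc (posOf i xs))

data Ord3 : Set where
  lt eq gt : Ord3

-- A refined segment: its interval together with a flag telling whether it
-- was produced by an Active Split (true = canonical).
RSeg : Set
RSeg = Interval × Bool

-- Haplotypes: S i j is the symbol S_i[j] (i ∈ 1..h, j ∈ 1..m; 1-based,
-- other values are never inspected).  d is the algorithm parameter.
module PBWT (h m d : ℕ) (S : ℕ → ℕ → ℕ) where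

  colex : ℕ → ℕ → ℕ → Ord3
  colex a b zero    = eq
  colex a b (suc k) =
    if S a (suc k) <ᵇ S b (suc k) then lt
    else (if S b (suc k) <ᵇ S a (suc k) then gt else colex a b k)

  -- a precedes b in col_j(PA): co-lex order of S_·[1..j-1], ties broken stably (by index)
  before : ℕ → ℕ → ℕ → Bool
  before j a b with colex a b (j ∸ 1)
  ... | lt = true
  ... | gt = false
  ... | eq = a <ᵇ b

  insert : ℕ → ℕ → List ℕ → List ℕ
  insert j x []       = [ x ]
  insert j x (y ∷ ys) = if before j x y then x ∷ y ∷ ys else y ∷ insert j x ys

  -- col_j(PA) as a list (column 1 is 1,…,h)
  colPA : ℕ → List ℕ
  colPA j = foldr (insert j) [] (oneTo h)

  PA : ℕ → ℕ → ℕ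
  PA j x = nth (colPA j) x

  PBWTat : ℕ → ℕ → ℕ
  PBWTat j x = S (PA j x) j

  runTopᵇ : ℕ → ℕ → Bool
  runTopᵇ j x = (x ≡ᵇ 1) ∨ not (PBWTat j x ≡ᵇ PBWTat j (x ∸ 1))

  pos : ℕ → ℕ → ℕ
  pos j i = posOf i (colPA j)

  φ : ℕ → ℕ → ℕ
  φ j i = if pos j i ≡ᵇ 1 then 0 else PA j (pos j i ∸ 1)

  boundaryᵇ : ℕ → ℕ → Bool
  boundaryᵇ i j = (j ≡ᵇ m) ∨ any (λ x → runTopᵇ j x ∧ (PA j x ≡ᵇ i)) (oneTo h)

  hapIntervals : ℕ → List Interval
  hapIntervals i = go 1 (oneTo m)
    where
    go : ℕ → List ℕ → List Interval
    go s []       = []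
    go s (j ∷ js) = if boundaryᵇ i j then (s , j) ∷ go (suc j) js else go s js

  countOverlap : Interval → List RSeg → ℕ
  countOverlap I []              = 0
  countOverlap I ((J , _) ∷ rs)  = if overlapᵇ I J then suc (countOverlap I rs) else countOverlap I rs

  update : {A : Set} → (ℕ → A) → ℕ → A → (ℕ → A)
  update f c v c'' = if c'' ≡ᵇ c then v else f c''

  -- algorithm state: the lists L_c and RS[c]
  State : Set
  State = (ℕ → List Interval) × (ℕ → List RSeg)

  initState : State
  initState = hapIntervals , (λ _ → [])

  step : ℕ → ℕ → State → State
  step j i (L , RS) = go (L c)
    where
    c : ℕ
    c = PA j i
    go : List Interval → State
    go []                = L , RS
    go ((b , e) ∷ rest)  =
      if j ≡ᵇ e
      then (update L c rest , update RS c (RS c ++ [ ((b , e) , false) ]))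
      else (if (1 <ᵇ i) ∧ (countOverlap (b , j) (RS (PA j (i ∸ 1))) ≡ᵇ d)
            then (update L c ((suc j , e) ∷ rest) , update RS c (RS c ++ [ ((b , j) , true) ]))
            else (L , RS))

  finalState : State
  finalState = foldl (λ st j → foldl (λ st′ i → step j i st′) st (oneTo h)) initState (oneTo m)

  RS : ℕ → List RSeg
  RS = proj₂ finalState

  RefinedSegment : Set
  RefinedSegment = Σ ℕ (λ c → Fin (length (RS c)))

  segOf : RefinedSegment → RSeg
  segOf (c , k) = lookup (RS c) k

  Canonical : RefinedSegment → Set
  Canonical s = proj₂ (segOf s) ≡ true

  Relevant : RefinedSegment → RefinedSegment → Set
  Relevant r s =
    (proj₁ r ≡ φ (proj₂ (proj₁ (segOf s))) (proj₁ s)) × T (overlapᵇ (proj₁ (segOf r)) (proj₁ (segOf s)))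

-- Every list RS[c] is a chain: its intervals are disjoint and increasing. A canonical segment
-- [b , e] of RS[c] is cut at the column e where the number of segments of RS[c′], c′ = φ_e(c),
-- overlapping [b , e] reaches d. The algorithm maintains for the head [b , E] of each L_c that
-- this number was still below d one column earlier, so some segment of RS[c′] ends exactly at e.
-- Moreover b and e lie in one haplotype interval of S_c, so c is no run-top in columns b … e−1;
-- since adjacent rows of the PBWT that agree on a symbol stay adjacent, φ_t(c) = c′ for all t in
-- [b , e].
-- If r ∈ RS[c′] overlaps [b , e], the segment of RS[c′] ending at e bounds the end t of r, so t
-- lies in [b , e] and φ_t(c) = c′. Hence two canonical segments to which r is relevant both
-- contain t and have owners with the same predecessor in column t; φ_t is injective, so the
-- owners coincide, and two segments of one chain sharing t are equal.

{-# OPTIONS --safe #-}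
module Submission where

open import Defs
open import Data.Nat
  using (ℕ; zero; suc; _+_; _∸_; _<_; _≤_; _≤ᵇ_; _<ᵇ_; _≡ᵇ_; z≤n; s≤s; z<s; s≤s⁻¹; _≟_; _≤?_)
open import Data.Nat.Properties
open import Data.Bool using (Bool; true; false; _∧_; T; if_then_else_)
open import Data.Bool.Properties using (T-∧; ∧-identityʳ)
open import Data.Bool.ListAction using (any)
open import Data.List using (List; []; _∷_; length; lookup; _++_; [_]; foldr; foldl; filter)
open import Data.List.Properties
  using (∷-injective; filter-accept; filter-reject; filter-none; filter-++; length-++)
open import Data.List.Relation.Unary.All as All using (All; []; _∷_)
import Data.List.Relation.Unary.All.Properties as Allₚ
open import Data.List.Relation.Unary.AllPairs as AllPairs using (AllPairs; []; _∷_)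
import Data.List.Relation.Unary.AllPairs.Properties as AllPairsₚ
open import Data.List.Relation.Unary.Unique.Propositional using (Unique)
open import Data.List.Relation.Binary.Lex.Strict using (Lex-<; base; this; next)
import Data.List.Relation.Binary.Lex.Strict as Lex
open import Data.List.Relation.Binary.Pointwise as Pointwise using (Pointwise; Pointwise-≡⇒≡)
open import Relation.Binary using (IsStrictTotalOrder; tri<; tri≈; tri>)
open import Data.List.Membership.Propositional using (_∈_)
open import Data.List.Relation.Binary.Subset.Propositional using (_⊆_)
open import Data.List.Relation.Binary.Subset.Propositional.Properties
  using (⊆-refl; xs⊆xs++ys; Any-resp-⊆)
open import Data.List.Membership.Propositional.Properties using (∈-lookup)
open import Data.List.Relation.Binary.Permutation.Propositional
  using (_↭_; ↭-refl; ↭-prep; ↭-swap; ↭-trans; ↭-sym)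
open import Data.List.Relation.Binary.Permutation.Propositional.Properties
  using (All-resp-↭; ∈-resp-↭; ↭-length)
open import Data.List.Relation.Unary.Any as Any using (Any; here; there)
open import Data.List.Relation.Unary.Any.Properties using (lookup-index)
open import Data.Fin as Fin using (Fin)
open import Data.Product using (∃; _×_; _,_; proj₁; proj₂; uncurry)
open import Data.Sum using (_⊎_; inj₁; inj₂)
open import Data.Empty using (⊥; ⊥-elim)
open import Data.Unit using (⊤; tt)
open import Function using (_∘_; Equivalence)
open import Relation.Nullary using (¬_; contradiction; yes; no)
open import Relation.Nullary.Decidable using (_×-dec_)
open import Relation.Unary using (Decidable)
open import Relation.Nullary.Reflects using (Reflects; ofʸ; ofⁿ; det; fromEquivalence)
open import Relation.Binary.PropositionalEquality
  using (_≡_; _≢_; refl; sym; trans; cong; subst; subst₂; module ≡-Reasoning)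

module _ {P : Set} {b : Bool} (r : Reflects P b) where

  reflects-true : P → b ≡ true
  reflects-true p = det r (ofʸ p)

  reflects-false : ¬ P → b ≡ false
  reflects-false ¬p = det r (ofⁿ ¬p)

Reflects-map : ∀ {P Q : Set} {b} → (P → Q) → (Q → P) → Reflects P b → Reflects Q b
Reflects-map to from (ofʸ p)  = ofʸ (to p)
Reflects-map to from (ofⁿ ¬p) = ofⁿ (¬p ∘ from)

≡ᵇ-reflects-≡ : ∀ m n → Reflects (m ≡ n) (m ≡ᵇ n)
≡ᵇ-reflects-≡ m n = fromEquivalence (≡ᵇ⇒≡ m n) (≡⇒≡ᵇ m n)

∈-range⁺ : ∀ {z} a n → a ≤ z → z < a + n → z ∈ range a n
∈-range⁺ {z} a zero a≤z z<a+0 = contradiction (subst (z <_) (+-identityʳ a) z<a+0) (≤⇒≯ a≤z)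
∈-range⁺ {z} a (suc n) a≤z z<a+n with m≤n⇒m<n∨m≡n a≤z
... | inj₂ refl = here refl
... | inj₁ a<z  = there (∈-range⁺ (suc a) n a<z (subst (z <_) (+-suc a n) z<a+n))

∈-range⁻ : ∀ {z} a n → z ∈ range a n → a ≤ z × z < a + n
∈-range⁻ a (suc n) (here refl) = ≤-refl , m<m+n a z<s
∈-range⁻ {z} a (suc n) (there z∈) with ∈-range⁻ (suc a) n z∈
... | a<z , z<a+n = <⇒≤ a<z , subst (z <_) (sym (+-suc a n)) z<a+n

range-unique : ∀ a n → Unique (range a n)
range-unique a zero    = []
range-unique a (suc n) =
  All.tabulate (λ z∈ → <⇒≢ (proj₁ (∈-range⁻ (suc a) n z∈))) ∷ range-unique (suc a) n

length-range : ∀ a n → length (range a n) ≡ n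
length-range a zero    = refl
length-range a (suc n) = cong suc (length-range (suc a) n)

foldl-range-induction : {A : Set} (P : ℕ → A → Set) (f : A → ℕ → A) → ∀ a n {x} →
  (∀ {i y} → a ≤ i → i < a + n → P i y → P (suc i) (f y i)) →
  P a x → P (a + n) (foldl f x (range a n))
foldl-range-induction P f a zero step Pa = subst (λ k → P k _) (sym (+-identityʳ a)) Pa
foldl-range-induction P f a (suc n) {x} step Pa =
  subst (λ k → P k (foldl f (f x a) (range (suc a) n))) (sym (+-suc a n))
    (foldl-range-induction P f (suc a) n
      (λ {i} a<i i< → step (<⇒≤ a<i) (subst (i <_) (sym (+-suc a n)) i<))
      (step ≤-refl (m<m+n a z<s) Pa))

nth-∈ : ∀ l k → k < length l → nth l (suc k) ∈ l
nth-∈ (x ∷ xs) zero    _         = here refl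
nth-∈ (x ∷ xs) (suc k) (s≤s k<) = there (nth-∈ xs k k<)

nth-AllPairs : ∀ {R : ℕ → ℕ → Set} l {k₁ k₂} → AllPairs R l → k₁ < k₂ → k₂ < length l →
               R (nth l (suc k₁)) (nth l (suc k₂))
nth-AllPairs (x ∷ xs) {zero}   {suc k₂} (x~ ∷ _)   _          (s≤s k₂<) =
  All.lookup x~ (nth-∈ xs k₂ k₂<)
nth-AllPairs (x ∷ xs) {suc k₁} {suc k₂} (_ ∷ xs~) (s≤s k₁<k₂) (s≤s k₂<) =
  nth-AllPairs xs xs~ k₁<k₂ k₂<

∈⇒posOf≡suc : ∀ {i} l → i ∈ l → ∃ λ k → posOf i l ≡ suc k
∈⇒posOf≡suc {i} (x ∷ xs) i∈ with x ≡ᵇ i | ≡ᵇ-reflects-≡ x i | i∈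
... | true  | _       | _          = zero , refl
... | false | ofⁿ x≢i | here refl  = contradiction refl x≢i
... | false | _       | there i∈xs with ∈⇒posOf≡suc xs i∈xs
...   | k , posOf≡ rewrite posOf≡ = suc k , refl

posOf≡suc⇒nth : ∀ {i k} l → posOf i l ≡ suc k → k < length l × nth l (suc k) ≡ i
posOf≡suc⇒nth {i} (x ∷ xs) posOf≡ with x ≡ᵇ i | ≡ᵇ-reflects-≡ x i
... | true  | ofʸ x≡i with refl ← posOf≡ = z<s , x≡i
... | false | _ with posOf i xs in posOf≡′
...   | suc k′ with refl ← posOf≡ with posOf≡suc⇒nth xs posOf≡′
...       | k′< , nth≡ = s≤s k′< , nth≡

posOf-nth : ∀ l k → Unique l → k < length l → posOf (nth l (suc k)) l ≡ suc k
posOf-nth (x ∷ xs) zero    _             _ rewrite reflects-true (≡ᵇ-reflects-≡ x x) refl = refl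
posOf-nth (x ∷ xs) (suc k) (x≢ ∷ xs-uq) (s≤s k<)
  rewrite reflects-false (≡ᵇ-reflects-≡ x (nth xs (suc k))) (All.lookup x≢ (nth-∈ xs k k<))
        | posOf-nth xs k xs-uq k< = refl

AllPairs-lookup : ∀ {A : Set} {R : A → A → Set} {xs} → AllPairs R xs → (i j : Fin (length xs)) →
                  i ≡ j ⊎ R (lookup xs i) (lookup xs j) ⊎ R (lookup xs j) (lookup xs i)
AllPairs-lookup (x~ ∷ _)   Fin.zero    Fin.zero    = inj₁ refl
AllPairs-lookup (x~ ∷ _)   Fin.zero    (Fin.suc j) = inj₂ (inj₁ (All.lookup x~ (∈-lookup j)))
AllPairs-lookup (x~ ∷ _)   (Fin.suc i) Fin.zero    = inj₂ (inj₂ (All.lookup x~ (∈-lookup i)))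
AllPairs-lookup (_ ∷ xs~) (Fin.suc i) (Fin.suc j) with AllPairs-lookup xs~ i j
... | inj₁ i≡j = inj₁ (cong Fin.suc i≡j)
... | inj₂ Rij = inj₂ Rij

overlapᵇ⇒ : ∀ (I J : Interval) → T (overlapᵇ I J) → proj₁ I ≤ proj₂ J × proj₁ J ≤ proj₂ I
overlapᵇ⇒ (b₁ , e₁) (b₂ , e₂) ov
  with _ , ov′ ← Equivalence.to (T-∧ {b₁ ≤ᵇ e₁}) ov
  with _ , ov″ ← Equivalence.to (T-∧ {b₂ ≤ᵇ e₂}) ov′
  with b₁≤e₂ , b₂≤e₁ ← Equivalence.to (T-∧ {b₁ ≤ᵇ e₂}) ov″
  = ≤ᵇ⇒≤ b₁ e₂ b₁≤e₂ , ≤ᵇ⇒≤ b₂ e₁ b₂≤e₁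

any-false : ∀ {A : Set} (p : A → Bool) {x} xs → any p xs ≡ false → x ∈ xs → p x ≡ false
any-false p (y ∷ ys) any≡ x∈ with p y in py | x∈
... | false | here refl = py
... | false | there x∈ys = any-false p ys any≡ x∈ys

start end : RSeg → ℕ
start ((b , _) , _) = b
end   ((_ , e) , _) = e

Nonempty : RSeg → Set
Nonempty y = start y ≤ end y

_⋖_ : RSeg → RSeg → Set
y ⋖ z = end y < start z

Chain : List RSeg → Set
Chain R = All Nonempty R × AllPairs _⋖_ R

Chain-∷ʳ : ∀ {R z} → Chain R → Nonempty z → All (_⋖ z) R → Chain (R ++ [ z ])
Chain-∷ʳ (R-ne , R-ord) z-ne R⋖z =
  Allₚ.++⁺ R-ne (z-ne ∷ []) , AllPairsₚ.++⁺ R-ord ([] ∷ []) (All.map (_∷ []) R⋖z)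

Chain-overlap⇒≡ : ∀ {R} → Chain R → (i j : Fin (length R)) →
                  start (lookup R i) ≤ end (lookup R j) → start (lookup R j) ≤ end (lookup R i) → i ≡ j
Chain-overlap⇒≡ (_ , R-ord) i j si≤ej sj≤ei with AllPairs-lookup R-ord i j
... | inj₁ i≡j        = i≡j
... | inj₂ (inj₁ i⋖j) = contradiction sj≤ei (<⇒≱ i⋖j)
... | inj₂ (inj₂ j⋖i) = contradiction si≤ej (<⇒≱ j⋖i)

Chain-end-≤ : ∀ {R} → Chain R → (i j : Fin (length R)) →
              start (lookup R i) ≤ end (lookup R j) → end (lookup R i) ≤ end (lookup R j)
Chain-end-≤ (R-ne , R-ord) i j si≤ej with AllPairs-lookup R-ord i j
... | inj₁ refl       = ≤-refl
... | inj₂ (inj₁ i⋖j) = <⇒≤ (<-≤-trans i⋖j (All.lookup R-ne (∈-lookup j)))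
... | inj₂ (inj₂ j⋖i) = contradiction si≤ej (<⇒≱ j⋖i)

EndsIn : ℕ → ℕ → RSeg → Set
EndsIn b t y = b ≤ end y × end y ≤ t

endsIn? : ∀ b t → Decidable (EndsIn b t)
endsIn? b t y = b ≤? end y ×-dec end y ≤? t

-- Unlike countOverlap, this count ignores segments ending after t, so appending them leaves it
-- unchanged; on the lists inspected by the algorithm the two agree (countOverlap≡endsIn).
endsIn : ℕ → ℕ → List RSeg → ℕ
endsIn b t R = length (filter (endsIn? b t) R)

endsIn-late : ∀ {b t R} → All (λ y → t < end y) R → endsIn b t R ≡ 0
endsIn-late t<R =
  cong length (filter-none (endsIn? _ _) (All.map (λ t<e (_ , e≤t) → <⇒≱ t<e e≤t) t<R))

endsIn-∷ʳ-late : ∀ b t R {z} → t < end z → endsIn b t (R ++ [ z ]) ≡ endsIn b t R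
endsIn-∷ʳ-late b t R {z} t<z = begin
  length (filter P? (R ++ [ z ]))                  ≡⟨ cong length (filter-++ P? R [ z ]) ⟩
  length (filter P? R ++ filter P? [ z ])          ≡⟨ length-++ (filter P? R) ⟩
  endsIn b t R + endsIn b t [ z ]                  ≡⟨ cong (endsIn b t R +_) (endsIn-late {b} (t<z ∷ [])) ⟩
  endsIn b t R + 0                                 ≡⟨ +-identityʳ _ ⟩
  endsIn b t R                                     ∎
  where
  open ≡-Reasoning
  P? = endsIn? b t

endsIn-early : ∀ {b t} R → t < b → endsIn b t R ≡ 0
endsIn-early R t<b = cong length (filter-none (endsIn? _ _)
  (All.tabulate {xs = R} λ _ (b≤e , e≤t) → <⇒≱ t<b (≤-trans b≤e e≤t)))

endsIn-accept : ∀ {b t} y R → EndsIn b t y → endsIn b t (y ∷ R) ≡ suc (endsIn b t R)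
endsIn-accept y R ok = cong length (filter-accept (endsIn? _ _) {xs = R} ok)

endsIn-reject : ∀ {b t} y R → ¬ EndsIn b t y → endsIn b t (y ∷ R) ≡ endsIn b t R
endsIn-reject y R ¬ok = cong length (filter-reject (endsIn? _ _) {xs = R} ¬ok)

endsIn-∷-≤ : ∀ b t y R → endsIn b t (y ∷ R) ≤ suc (endsIn b t R)
endsIn-∷-≤ b t y R with endsIn? b t y
... | yes ok = ≤-reflexive (endsIn-accept y R ok)
... | no ¬ok = ≤-trans (≤-reflexive (endsIn-reject y R ¬ok)) (n≤1+n _)

EndsIn-suc⁻ : ∀ {b t} y → end y ≢ suc t → EndsIn b (suc t) y → EndsIn b t y
EndsIn-suc⁻ y e≢ (b≤e , e≤1+t) = b≤e , m<1+n⇒m≤n (≤∧≢⇒< e≤1+t e≢)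

EndsIn-suc⁺ : ∀ {b t} y → EndsIn b t y → EndsIn b (suc t) y
EndsIn-suc⁺ y (b≤e , e≤t) = b≤e , m≤n⇒m≤1+n e≤t

endsIn-suc-≤ : ∀ b t {R} → Chain R → endsIn b (suc t) R ≤ suc (endsIn b t R)
endsIn-suc-≤ b t {[]} _ = z≤n
endsIn-suc-≤ b t {y ∷ R} (_ ∷ R-ne , y⋖R ∷ R-ord) with end y ≟ suc t
... | yes e≡ = begin
  endsIn b (suc t) (y ∷ R)  ≤⟨ endsIn-∷-≤ b (suc t) y R ⟩
  suc (endsIn b (suc t) R)  ≡⟨ cong suc (endsIn-late {b} later) ⟩
  1                         ≤⟨ s≤s z≤n ⟩
  suc (endsIn b t (y ∷ R))  ∎
  where
  open ≤-Reasoning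
  later : All (λ z → suc t < end z) R
  later = All.zipWith (λ {z} (y⋖z , z-ne) → subst (_< end z) e≡ (<-≤-trans y⋖z z-ne)) (y⋖R , R-ne)
... | no e≢ with endsIn? b (suc t) y | endsIn? b t y
...   | yes ok₁ | yes ok =
  subst₂ _≤_ (sym (endsIn-accept y R ok₁)) (cong suc (sym (endsIn-accept y R ok)))
    (s≤s (endsIn-suc-≤ b t (R-ne , R-ord)))
...   | no ¬ok₁ | no ¬ok =
  subst₂ _≤_ (sym (endsIn-reject y R ¬ok₁)) (cong suc (sym (endsIn-reject y R ¬ok)))
    (endsIn-suc-≤ b t (R-ne , R-ord))
...   | yes ok₁ | no ¬ok = contradiction (EndsIn-suc⁻ y e≢ ok₁) ¬ok
...   | no ¬ok₁ | yes ok = contradiction (EndsIn-suc⁺ y ok) ¬ok₁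

endsIn-suc-new : ∀ b t R → endsIn b t R < endsIn b (suc t) R → Any (λ y → end y ≡ suc t) R
endsIn-suc-new b t (y ∷ R) grows with end y ≟ suc t
... | yes e≡ = here e≡
... | no e≢ with endsIn? b (suc t) y | endsIn? b t y
...   | yes ok₁ | yes ok =
  there (endsIn-suc-new b t R (s≤s⁻¹ (subst₂ _<_ (endsIn-accept y R ok) (endsIn-accept y R ok₁) grows)))
...   | no ¬ok₁ | no ¬ok =
  there (endsIn-suc-new b t R (subst₂ _<_ (endsIn-reject y R ¬ok) (endsIn-reject y R ¬ok₁) grows))
...   | yes ok₁ | no ¬ok = contradiction (EndsIn-suc⁻ y e≢ ok₁) ¬ok
...   | no ¬ok₁ | yes ok = contradiction (EndsIn-suc⁺ y ok) ¬ok₁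

module Decomposition (h m d : ℕ) (S : ℕ → ℕ → ℕ) where
  open PBWT h m d S

  countOverlap≡endsIn : ∀ {b t} R → b ≤ t → All (λ y → Nonempty y × end y ≤ t) R →
                        countOverlap (b , t) R ≡ endsIn b t R
  countOverlap≡endsIn [] _ _ = refl
  countOverlap≡endsIn {b} {t} (((s , e) , _) ∷ R) b≤t ((s≤e , e≤t) ∷ R-ok)
    rewrite reflects-true (≤ᵇ-reflects-≤ b t) b≤t
          | reflects-true (≤ᵇ-reflects-≤ s e) s≤e
          | reflects-true (≤ᵇ-reflects-≤ s t) (≤-trans s≤e e≤t)
          | reflects-true (≤ᵇ-reflects-≤ e t) e≤t
    with b ≤? e
  ... | yes b≤e rewrite reflects-true  (≤ᵇ-reflects-≤ b e) b≤e =
    cong suc (countOverlap≡endsIn R b≤t R-ok)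
  ... | no  b≰e rewrite reflects-false (≤ᵇ-reflects-≤ b e) b≰e =
    countOverlap≡endsIn R b≤t R-ok

  -- colexKey k a = S_a[k] ∷ … ∷ S_a[1] ∷ a ∷ []; the lexicographic order of these keys is the
  -- order of col_{k+1}(PA): co-lexicographic on S_a[1..k], ties broken by the index a.
  colexKey : ℕ → ℕ → List ℕ
  colexKey zero    a = [ a ]
  colexKey (suc k) a = S a (suc k) ∷ colexKey k a

  _≺_ : List ℕ → List ℕ → Set
  _≺_ = Lex-< _≡_ _<_

  Before : ℕ → ℕ → ℕ → Set
  Before j a b = colexKey (j ∸ 1) a ≺ colexKey (j ∸ 1) b

  ≺-isStrictTotalOrder : IsStrictTotalOrder (Pointwise _≡_) _≺_
  ≺-isStrictTotalOrder = Lex.<-isStrictTotalOrder <-isStrictTotalOrder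

  module ≺ = IsStrictTotalOrder ≺-isStrictTotalOrder

  ordering : Ord3 → Bool → Bool
  ordering lt _ = true
  ordering eq b = b
  ordering gt _ = false

  before≡ordering : ∀ j a b → before j a b ≡ ordering (colex a b (j ∸ 1)) (a <ᵇ b)
  before≡ordering j a b with colex a b (j ∸ 1)
  ... | lt = refl
  ... | eq = refl
  ... | gt = refl

  colex-reflects : ∀ k a b → Reflects (colexKey k a ≺ colexKey k b) (ordering (colex a b k) (a <ᵇ b))
  colex-reflects zero a b with a <ᵇ b | <ᵇ-reflects-< a b
  ... | true  | ofʸ a<b = ofʸ (this a<b)
  ... | false | ofⁿ a≮b = ofⁿ λ { (this a<b) → a≮b a<b ; (next _ (base ())) }
  colex-reflects (suc k) a b with S a (suc k) <ᵇ S b (suc k) | <ᵇ-reflects-< (S a (suc k)) (S b (suc k))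
  ... | true  | ofʸ x<y = ofʸ (this x<y)
  ... | false | ofⁿ x≮y with S b (suc k) <ᵇ S a (suc k) | <ᵇ-reflects-< (S b (suc k)) (S a (suc k))
  ...   | true  | ofʸ y<x = ofⁿ λ { (this x<y) → x≮y x<y ; (next x≡y _) → <-irrefl (sym x≡y) y<x }
  ...   | false | ofⁿ y≮x = Reflects-map (next (≤-antisym (≮⇒≥ y≮x) (≮⇒≥ x≮y)))
                               (λ { (this x<y) → contradiction x<y x≮y ; (next _ key<) → key< })
                               (colex-reflects k a b)

  before-reflects : ∀ j a b → Reflects (Before j a b) (before j a b)
  before-reflects j a b rewrite before≡ordering j a b = colex-reflects (j ∸ 1) a b

  colexKey-injective : ∀ k {a b} → colexKey k a ≡ colexKey k b → a ≡ b
  colexKey-injective zero    refl = refl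
  colexKey-injective (suc k) key≡ = colexKey-injective k (proj₂ (∷-injective key≡))

  Before-irrefl : ∀ j a → ¬ Before j a a
  Before-irrefl j a = ≺.irrefl (Pointwise.refl refl)

  Before-total : ∀ j {a b} → a ≢ b → Before j a b ⊎ Before j b a
  Before-total j {a} {b} a≢b with ≺.compare (colexKey (j ∸ 1) a) (colexKey (j ∸ 1) b)
  ... | tri< a<b _ _ = inj₁ a<b
  ... | tri≈ _ a≈b _ = contradiction (colexKey-injective (j ∸ 1) (Pointwise-≡⇒≡ a≈b)) a≢b
  ... | tri> _ _ b<a = inj₂ b<a

  Row : ℕ → Set
  Row c = 1 ≤ c × c ≤ h

  insert-↭ : ∀ j x l → insert j x l ↭ x ∷ l
  insert-↭ j x [] = ↭-refl
  insert-↭ j x (y ∷ ys) with before j x y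
  ... | true  = ↭-refl
  ... | false = ↭-trans (↭-prep y (insert-↭ j x ys)) (↭-swap y x ↭-refl)

  insert-sorted : ∀ j x l → AllPairs (Before j) l → All (x ≢_) l → AllPairs (Before j) (insert j x l)
  insert-sorted j x [] _ _ = [] ∷ []
  insert-sorted j x (y ∷ ys) (y< ∷ ys-sorted) (x≢y ∷ x≢ys) with before j x y | before-reflects j x y
  ... | true  | ofʸ x<y = (x<y ∷ All.map (≺.trans x<y) y<) ∷ y< ∷ ys-sorted
  ... | false | ofⁿ x≮y with Before-total j x≢y
  ...   | inj₁ x<y = contradiction x<y x≮y
  ...   | inj₂ y<x =
    All-resp-↭ (↭-sym (insert-↭ j x ys)) (y<x ∷ y<) ∷ insert-sorted j x ys ys-sorted x≢ys

  insertionSort-↭ : ∀ j xs → foldr (insert j) [] xs ↭ xs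
  insertionSort-↭ j []       = ↭-refl
  insertionSort-↭ j (x ∷ xs) = ↭-trans (insert-↭ j x _) (↭-prep x (insertionSort-↭ j xs))

  insertionSort-sorted : ∀ j xs → Unique xs → AllPairs (Before j) (foldr (insert j) [] xs)
  insertionSort-sorted j []       _              = []
  insertionSort-sorted j (x ∷ xs) (x≢xs ∷ xs-uq) =
    insert-sorted j x _ (insertionSort-sorted j xs xs-uq)
      (All-resp-↭ (↭-sym (insertionSort-↭ j xs)) x≢xs)

  colPA-sorted : ∀ j → AllPairs (Before j) (colPA j)
  colPA-sorted j = insertionSort-sorted j (oneTo h) (range-unique 1 h)

  colPA-unique : ∀ j → Unique (colPA j)
  colPA-unique j =
    AllPairs.map (λ {a} {b} a<b a≡b → Before-irrefl j b (subst (λ x → Before j x b) a≡b a<b)) (colPA-sorted j)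

  length-colPA : ∀ j → length (colPA j) ≡ h
  length-colPA j = trans (↭-length (insertionSort-↭ j (oneTo h))) (length-range 1 h)

  Row⇒∈colPA : ∀ j {c} → Row c → c ∈ colPA j
  Row⇒∈colPA j (1≤c , c≤h) =
    ∈-resp-↭ (↭-sym (insertionSort-↭ j (oneTo h))) (∈-range⁺ 1 h 1≤c (s≤s c≤h))

  ∈colPA⇒Row : ∀ j {c} → c ∈ colPA j → Row c
  ∈colPA⇒Row j c∈ with 1≤c , c<1+h ← ∈-range⁻ 1 h (∈-resp-↭ (insertionSort-↭ j (oneTo h)) c∈) =
    1≤c , s≤s⁻¹ c<1+h

  NotFirst : ℕ → ℕ → Set
  NotFirst j c = ∃ λ k → pos j c ≡ suc (suc k)

  Row⇒pos≡suc : ∀ j {c} → Row c → ∃ λ k → pos j c ≡ suc k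
  Row⇒pos≡suc j c-row = ∈⇒posOf≡suc (colPA j) (Row⇒∈colPA j c-row)

  pos≡suc⇒PA : ∀ j {c k} → pos j c ≡ suc k → k < h × PA j (suc k) ≡ c
  pos≡suc⇒PA j {k = k} pos≡ with k< , PA≡ ← posOf≡suc⇒nth (colPA j) pos≡ =
    subst (k <_) (length-colPA j) k< , PA≡

  <length-colPA : ∀ j {k} → k < h → k < length (colPA j)
  <length-colPA j {k} = subst (k <_) (sym (length-colPA j))

  PA-Row : ∀ j {k} → k < h → Row (PA j (suc k))
  PA-Row j k< = ∈colPA⇒Row j (nth-∈ (colPA j) _ (<length-colPA j k<))

  pos-PA : ∀ j {k} → k < h → pos j (PA j (suc k)) ≡ suc k
  pos-PA j k< = posOf-nth (colPA j) _ (colPA-unique j) (<length-colPA j k<)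

  pos<⇒Before : ∀ j {p q} → p < q → q < h → Before j (PA j (suc p)) (PA j (suc q))
  pos<⇒Before j p<q q<h = nth-AllPairs (colPA j) (colPA-sorted j) p<q (<length-colPA j q<h)

  Before⇒pos< : ∀ j {a b p q} → Before j a b → pos j a ≡ suc p → pos j b ≡ suc q → p < q
  Before⇒pos< j {a} {b} {p} {q} a<b pos-a pos-b with p<h , PA-p ← pos≡suc⇒PA j pos-a
                                                  with q<h , PA-q ← pos≡suc⇒PA j pos-b
                                                  with <-cmp p q
  ... | tri< p<q _ _ = p<q
  ... | tri≈ _ refl _ = contradiction (subst₂ (Before j) (sym PA-p) (sym PA-q) a<b) (Before-irrefl j _)
  ... | tri> _ _ q<p = contradiction (subst₂ (Before j) PA-q PA-p (pos<⇒Before j q<p p<h)) (≺.asym a<b)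

  φ-PA : ∀ j {c k} → pos j c ≡ suc (suc k) → φ j c ≡ PA j (suc k)
  φ-PA j pos≡ rewrite pos≡ = refl

  φ-first : ∀ j {c} → pos j c ≡ 1 → φ j c ≡ 0
  φ-first j pos≡ rewrite pos≡ = refl

  pos-φ : ∀ j {c k} → pos j c ≡ suc (suc k) → pos j (φ j c) ≡ suc k
  pos-φ j pos≡ =
    trans (cong (pos j) (φ-PA j pos≡)) (pos-PA j (<-trans (n<1+n _) (proj₁ (pos≡suc⇒PA j pos≡))))

  φ-Row : ∀ j {c} → NotFirst j c → Row (φ j c)
  φ-Row j (k , pos≡) =
    subst Row (sym (φ-PA j pos≡)) (PA-Row j (<-trans (n<1+n k) (proj₁ (pos≡suc⇒PA j pos≡))))

  φ-Before : ∀ j {c} → NotFirst j c → Before j (φ j c) c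
  φ-Before j (k , pos≡) with k+1<h , PA≡c ← pos≡suc⇒PA j pos≡ =
    subst₂ (Before j) (sym (φ-PA j pos≡)) PA≡c (pos<⇒Before j (n<1+n k) k+1<h)

  φ-injective : ∀ j {c₁ c₂} → NotFirst j c₁ → NotFirst j c₂ → φ j c₁ ≡ φ j c₂ → c₁ ≡ c₂
  φ-injective j (k₁ , pos₁) (k₂ , pos₂) φ≡
    with refl ← trans (sym (pos-φ j pos₁)) (trans (cong (pos j) φ≡) (pos-φ j pos₂))
    = trans (sym (proj₂ (pos≡suc⇒PA j pos₁))) (proj₂ (pos≡suc⇒PA j pos₂))

  φ-adjacent : ∀ j {c z} → NotFirst j c → Row z → Before j (φ j c) z → Before j z c → ⊥
  φ-adjacent j {c} (k , pos≡) z-row φ<z z<c with r , pos-z ← Row⇒pos≡suc j z-row =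
    <⇒≱ (Before⇒pos< j φ<z (pos-φ j pos≡) pos-z) (s≤s⁻¹ (Before⇒pos< j z<c pos-z pos≡))

  Before-suc⇒≤ : ∀ k {a b} → Before (suc (suc k)) a b → S a (suc k) ≤ S b (suc k)
  Before-suc⇒≤ k (this x<y)   = <⇒≤ x<y
  Before-suc⇒≤ k (next x≡y _) = ≤-reflexive x≡y

  Before-suc⁻ : ∀ k {a b} → S a (suc k) ≡ S b (suc k) → Before (suc (suc k)) a b → Before (suc k) a b
  Before-suc⁻ k x≡y (this x<y)   = contradiction x<y (<-irrefl x≡y)
  Before-suc⁻ k x≡y (next _ a<b) = a<b

  Before-squeeze : ∀ k {a z b} → S a (suc k) ≡ S b (suc k) →
                   Before (suc (suc k)) a z → Before (suc (suc k)) z b → Before (suc k) a z × Before (suc k) z b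
  Before-squeeze k {a} {z} {b} a≡b a<z z<b =
    Before-suc⁻ k a≡z a<z , Before-suc⁻ k (trans (sym a≡z) a≡b) z<b
    where
    a≡z : S a (suc k) ≡ S z (suc k)
    a≡z = ≤-antisym (Before-suc⇒≤ k a<z) (subst (S z (suc k) ≤_) (sym a≡b) (Before-suc⇒≤ k z<b))

  Before⇒NotFirst : ∀ j {a c} → Row a → Row c → Before j a c → NotFirst j c
  Before⇒NotFirst j a-row c-row a<c with Row⇒pos≡suc j a-row | Row⇒pos≡suc j c-row
  ... | p , pos-a | zero  , pos-c = contradiction (Before⇒pos< j a<c pos-a pos-c) (λ ())
  ... | p , pos-a | suc q , pos-c = q , pos-c

  φ-stable : ∀ t {c} → 1 ≤ t → Row c → NotFirst t c → S c t ≡ S (φ t c) t →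
             NotFirst (suc t) c × φ (suc t) c ≡ φ t c
  φ-stable (suc k) {c} _ c-row nf same = nf′ , φ≡
    where
    t = suc k
    t′ = suc t
    c′ = φ t c
    c′-row = φ-Row t nf
    c′<c : Before t′ c′ c
    c′<c = next (sym same) (φ-Before t nf)
    nf′ = Before⇒NotFirst t′ c′-row c-row c′<c
    φ≡ : φ t′ c ≡ c′
    φ≡ with φ t′ c ≟ c′
    ... | yes φ≡c′ = φ≡c′
    ... | no  φ≢c′ with Before-total t′ φ≢c′
    ...   | inj₁ φ<c′ = ⊥-elim (φ-adjacent t′ nf′ c′-row φ<c′ c′<c)
    ...   | inj₂ c′<φ = ⊥-elim (uncurry (φ-adjacent t nf (φ-Row t′ nf′))
                                        (Before-squeeze k (sym same) c′<φ (φ-Before t′ nf′)))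

  BoundaryFree : ℕ → Interval → Set
  BoundaryFree c (b , E) = ∀ u → b ≤ u → u < E → boundaryᵇ c u ≡ false

  ¬boundary⇒¬runTop : ∀ {c t} → Row c → boundaryᵇ c t ≡ false →
                      ∃ λ r → pos t c ≡ suc r × runTopᵇ t (suc r) ≡ false
  ¬boundary⇒¬runTop {c} {t} c-row ¬bd
    with r , pos≡ ← Row⇒pos≡suc t c-row
    with r<h , PA≡c ← pos≡suc⇒PA t pos≡
    with t ≡ᵇ m
  ... | true  = contradiction ¬bd λ ()
  ... | false = r , pos≡ , (begin
    runTopᵇ t (suc r)
      ≡⟨ ∧-identityʳ _ ⟨
    runTopᵇ t (suc r) ∧ true
      ≡⟨ cong (runTopᵇ t (suc r) ∧_) (reflects-true (≡ᵇ-reflects-≡ _ c) PA≡c) ⟨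
    runTopᵇ t (suc r) ∧ (PA t (suc r) ≡ᵇ c)
      ≡⟨ any-false _ (oneTo h) ¬bd (∈-range⁺ 1 h (s≤s z≤n) (s≤s r<h)) ⟩
    false
      ∎)
    where open ≡-Reasoning

  ¬boundary⇒φ-continues : ∀ {c t} → Row c → boundaryᵇ c t ≡ false → NotFirst t c × S c t ≡ S (φ t c) t
  ¬boundary⇒φ-continues {c} {t} c-row ¬bd with ¬boundary⇒¬runTop c-row ¬bd
  ... | zero  , _    , ()
  ... | suc r , pos≡ , ¬top with PBWTat t (suc (suc r)) ≡ᵇ PBWTat t (suc r)
                               | ≡ᵇ-reflects-≡ (PBWTat t (suc (suc r))) (PBWTat t (suc r))
  ...   | false | _         = contradiction ¬top λ ()
  ...   | true  | ofʸ same = (r , pos≡) , subst₂ _≡_ (cong (λ x → S x t) (proj₂ (pos≡suc⇒PA t pos≡)))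
                                                    (cong (λ x → S x t) (sym (φ-PA t pos≡))) same

  φ-constant : ∀ {c t} n → Row c → 1 ≤ t → BoundaryFree c (t , n + t) → NotFirst (n + t) c →
               NotFirst t c × φ t c ≡ φ (n + t) c
  φ-constant zero    c-row 1≤t free nf = nf , refl
  φ-constant {t = t} (suc n) c-row 1≤t free nf =
    proj₁ earlier , trans (proj₂ earlier) (sym (proj₂ (uncurry (φ-stable (n + t) 1≤n+t c-row) continues)))
    where
    1≤n+t = ≤-trans 1≤t (m≤n+m t n)
    continues = ¬boundary⇒φ-continues c-row (free (n + t) (m≤n+m t n) (n<1+n _))
    earlier = φ-constant n c-row 1≤t (λ u t≤u u< → free u t≤u (m<n⇒m<1+n u<)) (proj₁ continues)

  StartsAt : ℕ → List Interval → Set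
  StartsAt s []            = ⊤
  StartsAt s ((b , _) ∷ _) = b ≡ s

  Contiguous : List Interval → Set
  Contiguous []            = ⊤
  Contiguous ((b , e) ∷ L) = b ≤ e × StartsAt (suc e) L × Contiguous L

  -- hapIntervals is defined through an anonymous local function; solving the metavariable hapGo
  -- by unification in hapIntervals≡hapGo names it, so that it can be reasoned about by induction.
  mutual
    hapGo : ℕ → ℕ → List ℕ → List Interval
    hapGo = _

    hapIntervals≡hapGo : ∀ c → hapIntervals c ≡ hapGo c 1 (oneTo m)
    hapIntervals≡hapGo c with oneTo m
    ... | js with 1
    ... | s = refl

  hapGo-wellFormed : ∀ c s a n → s ≤ a → BoundaryFree c (s , a) →
                     StartsAt s (hapGo c s (range a n)) × Contiguous (hapGo c s (range a n)) ×
                     All (BoundaryFree c) (hapGo c s (range a n))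
  hapGo-wellFormed c s a zero    _   _    = tt , tt , []
  hapGo-wellFormed c s a (suc n) s≤a free with boundaryᵇ c a in bd
  ... | true with starts , contiguous , frees ← hapGo-wellFormed c (suc a) (suc a) n ≤-refl
                                                 (λ u a<u u≤a → contradiction a<u (≤⇒≯ (s≤s⁻¹ u≤a)))
    = refl , (s≤a , starts , contiguous) , free ∷ frees
  ... | false = hapGo-wellFormed c s (suc a) n (m≤n⇒m≤1+n s≤a) free′
    where
    free′ : BoundaryFree c (s , suc a)
    free′ u s≤u u≤a with m≤n⇒m<n∨m≡n (s≤s⁻¹ u≤a)
    ... | inj₁ u<a  = free u s≤u u<a
    ... | inj₂ refl = bd

  hapIntervals-wellFormed : ∀ c → StartsAt 1 (hapIntervals c) × Contiguous (hapIntervals c) ×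
                                  All (BoundaryFree c) (hapIntervals c)
  hapIntervals-wellFormed c rewrite hapIntervals≡hapGo c =
    hapGo-wellFormed c 1 1 m ≤-refl (λ u 1≤u u<1 → contradiction u<1 (≤⇒≯ 1≤u))

  update-same : ∀ {A : Set} (f : ℕ → A) c v → update f c v c ≡ v
  update-same f c v rewrite reflects-true (≡ᵇ-reflects-≡ c c) refl = refl

  update-other : ∀ {A : Set} (f : ℕ → A) c v {x} → x ≢ c → update f c v x ≡ f x
  update-other f c v {x} x≢c rewrite reflects-false (≡ᵇ-reflects-≡ x c) x≢c = refl

  Segments : Set
  Segments = ℕ → List RSeg

  extend : Segments → ℕ → RSeg → Segments
  extend R c z = update R c (R c ++ [ z ])

  _⊑_ : Segments → Segments → Set
  R ⊑ R′ = ∀ c → R c ⊆ R′ c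

  ⊑-extend : ∀ R c z → R ⊑ extend R c z
  ⊑-extend R c z x with x ≟ c
  ... | yes refl = subst (R c ⊆_) (sym (update-same R c _)) (xs⊆xs++ys (R c) [ z ])
  ... | no  x≢c  = subst (R x ⊆_) (sym (update-other R c _ x≢c)) ⊆-refl

  Anchored : Segments → ℕ → Interval → Set
  Anchored R c (b , e) = (∀ t → b ≤ t → t ≤ e → NotFirst t c × φ t c ≡ φ e c)
                       × Any (λ y → end y ≡ e) (R (φ e c))

  Anchored-mono : ∀ {R R′} c I → R ⊑ R′ → Anchored R c I → Anchored R′ c I
  Anchored-mono c (b , e) R⊑R′ (constant , ends) = constant , Any-resp-⊆ (R⊑R′ (φ e c)) ends

  record HeadOK (p : ℕ) (R : Segments) (c b E : ℕ) : Set where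
    field
      after    : All (λ y → end y < b) (R c)
      1≤b      : 1 ≤ b
      b≤1+p    : b ≤ suc p
      1+p≤E    : suc p ≤ E
      few-ends : b ≤ p → endsIn b p (R (φ p c)) < d

  HeadInv : ℕ → Segments → ℕ → List Interval → Set
  HeadInv p R c []            = ⊤
  HeadInv p R c ((b , E) ∷ _) = HeadOK p R c b E

  record RowInv (p : ℕ) (l : List Interval) (R : Segments) (c : ℕ) : Set where
    field
      chain      : Chain (R c)
      ends≤      : All (λ y → end y ≤ p) (R c)
      contiguous : Contiguous l
      free       : All (BoundaryFree c) l
      head       : HeadInv p R c l
      anchored   : All (λ y → proj₂ y ≡ true → Anchored R c (proj₁ y)) (R c)

  -- The last column in which row c has been processed before step (j , i) of the algorithm.
  lastCol : ℕ → ℕ → ℕ → ℕ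
  lastCol j i c = if pos j c <ᵇ i then j else j ∸ 1

  -- The second component keeps RS[0] empty: the first row of a column has φ = 0.
  Inv : ℕ → ℕ → State → Set
  Inv j i st = (∀ c → Row c → RowInv (lastCol j i c) (proj₁ st c) (proj₂ st) c)
             × (∀ c → ¬ Row c → proj₂ st c ≡ [])

  lastCol-current : ∀ j {k} → k < h → lastCol j (suc k) (PA j (suc k)) ≡ j ∸ 1
  lastCol-current j {k} k< rewrite pos-PA j k< | reflects-false (<ᵇ-reflects-< k k) (<-irrefl refl) = refl

  lastCol-next : ∀ j {k} → k < h → lastCol j (suc (suc k)) (PA j (suc k)) ≡ j
  lastCol-next j {k} k< rewrite pos-PA j k< | reflects-true (<ᵇ-reflects-< k (suc k)) (n<1+n k) = refl

  lastCol-other : ∀ j {k x} → Row x → x ≢ PA j (suc k) → lastCol j (suc (suc k)) x ≡ lastCol j (suc k) x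
  lastCol-other j {k} {x} x-row x≢c with p , pos≡ ← Row⇒pos≡suc j x-row rewrite pos≡ with <-cmp p k
  ... | tri< p<k _ _ rewrite reflects-true (<ᵇ-reflects-< p (suc k)) (m<n⇒m<1+n p<k)
                           | reflects-true (<ᵇ-reflects-< p k) p<k = refl
  ... | tri≈ _ refl _ = contradiction (sym (proj₂ (pos≡suc⇒PA j pos≡))) x≢c
  ... | tri> _ _ k<p rewrite reflects-false (<ᵇ-reflects-< p (suc k)) (≤⇒≯ k<p)
                           | reflects-false (<ᵇ-reflects-< p k) (<⇒≯ k<p) = refl

  lastCol-start : ∀ j {c} → Row c → lastCol (suc j) 1 c ≡ j
  lastCol-start j c-row with p , pos≡ ← Row⇒pos≡suc (suc j) c-row rewrite pos≡ = refl

  lastCol-end : ∀ j {c} → Row c → lastCol j (suc h) c ≡ j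
  lastCol-end j c-row with p , pos≡ ← Row⇒pos≡suc j c-row
    rewrite pos≡ | reflects-true (<ᵇ-reflects-< p h) (proj₁ (pos≡suc⇒PA j pos≡)) = refl

  Row⇒≢0 : ∀ {c} → Row c → c ≢ 0
  Row⇒≢0 (() , _) refl

  lastCol-φ : ∀ j {k x} → 1 ≤ j → k < h → Row x → φ (lastCol j (suc k) x) x ≡ PA j (suc k) →
              lastCol j (suc k) x < j
  lastCol-φ j@(suc _) {k} {x} _ k<h x-row φ≡ with pos j x <ᵇ suc k | <ᵇ-reflects-< (pos j x) (suc k)
  ... | false | _ = ≤-refl
  ... | true  | ofʸ pos<  with Row⇒pos≡suc j x-row
  ...   | zero , pos≡ = contradiction (trans (sym φ≡) (φ-first j pos≡)) (Row⇒≢0 (PA-Row j k<h))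
  ...   | suc p , pos≡ with refl ← trans (sym (pos-φ j pos≡)) (trans (cong (pos j) φ≡) (pos-PA j k<h))
    = contradiction (subst (_< suc k) pos≡ pos<) (≤⇒≯ (n≤1+n (suc k)))

  HeadInv-frame : ∀ {p R R′} x l → R′ x ≡ R x →
                  (∀ b → endsIn b p (R′ (φ p x)) ≡ endsIn b p (R (φ p x))) →
                  HeadInv p R x l → HeadInv p R′ x l
  HeadInv-frame x []            _  _     _  = tt
  HeadInv-frame x ((b , E) ∷ _) R≡ ends≡ hd = record
    { after    = subst (All (λ y → end y < b)) (sym R≡) after
    ; 1≤b      = 1≤b
    ; b≤1+p    = b≤1+p
    ; 1+p≤E    = 1+p≤E
    ; few-ends = λ b≤p → subst (_< d) (sym (ends≡ b)) (few-ends b≤p)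
    }
    where open HeadOK hd

  RowInv-frame : ∀ {p l R R′} x → R′ x ≡ R x → R ⊑ R′ →
                 (∀ b → endsIn b p (R′ (φ p x)) ≡ endsIn b p (R (φ p x))) →
                 RowInv p l R x → RowInv p l R′ x
  RowInv-frame {p} {l} {R} {R′} x R≡ R⊑R′ ends≡ inv = record
    { chain      = subst Chain (sym R≡) chain
    ; ends≤      = subst (All (λ y → end y ≤ p)) (sym R≡) ends≤
    ; contiguous = contiguous
    ; free       = free
    ; head       = HeadInv-frame x l R≡ ends≡ head
    ; anchored   = subst (All (λ y → proj₂ y ≡ true → Anchored R′ x (proj₁ y))) (sym R≡)
                     (All.map (λ anc f≡ → Anchored-mono x _ R⊑R′ (anc f≡)) anchored)
    }
    where open RowInv inv

  RowInv-advance : ∀ {p l R c} → RowInv p l R c → HeadInv (suc p) R c l → RowInv (suc p) l R c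
  RowInv-advance inv hd = record
    { chain = chain ; ends≤ = All.map m≤n⇒m≤1+n ends≤ ; contiguous = contiguous ; free = free
    ; head = hd ; anchored = anchored }
    where open RowInv inv

  HeadOK-advance : ∀ {p R c b E} → HeadOK p R c b E → suc p ≢ E →
                   (b ≤ suc p → endsIn b (suc p) (R (φ (suc p) c)) < d) → HeadOK (suc p) R c b E
  HeadOK-advance hd 1+p≢E few = record
    { after = after ; 1≤b = 1≤b ; b≤1+p = m≤n⇒m≤1+n b≤1+p ; 1+p≤E = ≤∧≢⇒< 1+p≤E 1+p≢E
    ; few-ends = few }
    where open HeadOK hd

  HeadInv-fresh : ∀ {p R c} l → StartsAt (suc p) l → Contiguous l → All (λ y → end y < suc p) (R c) →
                  HeadInv p R c l
  HeadInv-fresh []             _    _              _      = tt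
  HeadInv-fresh ((b , E) ∷ _) refl (b≤E , _ , _) before = record
    { after = before ; 1≤b = s≤s z≤n ; b≤1+p = ≤-refl ; 1+p≤E = b≤E
    ; few-ends = λ 1+p≤p → contradiction 1+p≤p (<-irrefl refl) }

  RowInv-cut : ∀ {j R c b E rest} f l → RowInv j ((b , E) ∷ rest) R c →
               StartsAt (suc (suc j)) l → Contiguous l → All (BoundaryFree c) l →
               (f ≡ true → Anchored (extend R c ((b , suc j) , f)) c (b , suc j)) →
               RowInv (suc j) l (extend R c ((b , suc j) , f)) c
  RowInv-cut {j} {R} {c} {b} f l inv starts contiguous′ free′ anchor = record
    { chain      = subst Chain (sym R′c≡) (Chain-∷ʳ chain b≤1+p after)
    ; ends≤      = subst (All (λ y → end y ≤ suc j)) (sym R′c≡)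
                     (Allₚ.++⁺ (All.map m≤n⇒m≤1+n ends≤) (≤-refl ∷ []))
    ; contiguous = contiguous′
    ; free       = free′
    ; head       = HeadInv-fresh l starts contiguous′ (subst (All (λ y → end y < suc (suc j))) (sym R′c≡)
                     (Allₚ.++⁺ (All.map (s≤s ∘ m≤n⇒m≤1+n) ends≤) (≤-refl ∷ [])))
    ; anchored   = subst (All (λ y → proj₂ y ≡ true → Anchored R′ c (proj₁ y))) (sym R′c≡)
                     (Allₚ.++⁺ (All.map (λ anc f≡ → Anchored-mono c _ (⊑-extend R c z) (anc f≡)) anchored)
                               (anchor ∷ []))
    }
    where
    open RowInv inv
    open HeadOK head
    z = ((b , suc j) , f)
    R′ = extend R c z
    R′c≡ : R′ c ≡ R c ++ [ z ]
    R′c≡ = update-same R c _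

  Inv-assemble : ∀ j k {L R L′ R′} → k < h → Inv j (suc k) (L , R) →
                 (∀ x → x ≢ PA j (suc k) → L′ x ≡ L x) →
                 (∀ x → x ≢ PA j (suc k) → R′ x ≡ R x) → R ⊑ R′ →
                 (∀ x → Row x → x ≢ PA j (suc k) → let p = lastCol j (suc k) x in
                   ∀ b → endsIn b p (R′ (φ p x)) ≡ endsIn b p (R (φ p x))) →
                 RowInv j (L′ (PA j (suc k))) R′ (PA j (suc k)) → Inv j (suc (suc k)) (L′ , R′)
  Inv-assemble j k {L} {R} {L′} {R′} k<h (rows , others) L≡ R≡ R⊑R′ ends≡ inv-c = rows′ , others′
    where
    c = PA j (suc k)
    rows′ : ∀ x → Row x → RowInv (lastCol j (suc (suc k)) x) (L′ x) R′ x
    rows′ x x-row with x ≟ c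
    ... | yes refl = subst (λ p → RowInv p (L′ c) R′ c) (sym (lastCol-next j k<h)) inv-c
    ... | no  x≢c  = subst₂ (λ p l → RowInv p l R′ x) (sym (lastCol-other j x-row x≢c)) (sym (L≡ x x≢c))
                       (RowInv-frame x (R≡ x x≢c) R⊑R′ (ends≡ x x-row x≢c) (rows x x-row))
    others′ : ∀ x → ¬ Row x → R′ x ≡ []
    others′ x ¬row = trans (R≡ x (λ { refl → ¬row (PA-Row j k<h) })) (others x ¬row)

  Inv-idle : ∀ j k {L R} → k < h → Inv j (suc k) (L , R) → RowInv j (L (PA j (suc k))) R (PA j (suc k)) →
             Inv j (suc (suc k)) (L , R)
  Inv-idle j k k<h inv =
    Inv-assemble j k k<h inv (λ _ _ → refl) (λ _ _ → refl) (λ _ → ⊆-refl) (λ _ _ _ _ → refl)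

  Inv-extend : ∀ j k {L R} z l → 1 ≤ j → k < h → end z ≡ j → Inv j (suc k) (L , R) →
               let c = PA j (suc k) in
               RowInv j l (extend R c z) c → Inv j (suc (suc k)) (update L c l , extend R c z)
  Inv-extend j k {L} {R} z l 1≤j k<h end≡ inv inv-c =
    Inv-assemble j k k<h inv (λ _ → update-other L c l) (λ _ → update-other R c _) (⊑-extend R c z) ends≡
      (subst (λ l′ → RowInv j l′ (extend R c z) c) (sym (update-same L c l)) inv-c)
    where
    c = PA j (suc k)
    ends≡ : ∀ x → Row x → x ≢ c → let p = lastCol j (suc k) x in
            ∀ b → endsIn b p (extend R c z (φ p x)) ≡ endsIn b p (R (φ p x))
    ends≡ x x-row x≢c b with φ (lastCol j (suc k) x) x ≟ c
    ... | no  φ≢c = cong (endsIn b _) (update-other R c _ φ≢c)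
    ... | yes φ≡c rewrite φ≡c | update-same R c (R c ++ [ z ]) =
      endsIn-∷ʳ-late b p (R c) (subst (p <_) (sym end≡) (lastCol-φ j 1≤j k<h x-row φ≡c))
      where p = lastCol j (suc k) x

  Inv-current : ∀ j k {L R} → k < h → Inv j (suc k) (L , R) →
                RowInv (j ∸ 1) (L (PA j (suc k))) R (PA j (suc k))
  Inv-current j k {L} {R} k<h (rows , _) =
    subst (λ p → RowInv p (L (PA j (suc k))) R (PA j (suc k))) (lastCol-current j k<h) (rows _ (PA-Row j k<h))

  Inv-previous : ∀ j k {L R} → suc k < h → Inv j (suc (suc k)) (L , R) →
                 RowInv j (L (PA j (suc k))) R (PA j (suc k))
  Inv-previous j k {L} {R} k+1<h (rows , _) =
    subst (λ p → RowInv p (L (PA j (suc k))) R (PA j (suc k))) (lastCol-next j k<h) (rows _ (PA-Row j k<h))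
    where k<h = <-trans (n<1+n k) k+1<h

  countOverlap-previous : ∀ j k {L R b} → suc k < h → Inv j (suc (suc k)) (L , R) → b ≤ j →
                          countOverlap (b , j) (R (PA j (suc k))) ≡ endsIn b j (R (PA j (suc k)))
  countOverlap-previous j k k+1<h inv b≤j = countOverlap≡endsIn _ b≤j (All.zip (proj₁ chain , ends≤))
    where open RowInv (Inv-previous j k k+1<h inv)

  few-ends-before : ∀ {j′ R c b E} → 0 < d → Row c → NotFirst (suc j′) c →
                    HeadOK j′ R c b E → BoundaryFree c (b , E) → endsIn b j′ (R (φ (suc j′) c)) < d
  few-ends-before {j′} {R} {c} {b} 0<d c-row nf hd free with b ≤? j′
  ... | no  b≰j′ = subst (_< d) (sym (endsIn-early (R (φ (suc j′) c)) (≰⇒> b≰j′))) 0<d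
  ... | yes b≤j′ = subst (λ x → endsIn b j′ (R x) < d) φ≡ (few-ends b≤j′)
    where
    open HeadOK hd
    φ≡ : φ j′ c ≡ φ (suc j′) c
    φ≡ = proj₂ (φ-constant 1 c-row (≤-trans 1≤b b≤j′)
                  (λ u j′≤u u≤j′ → free u (≤-trans b≤j′ j′≤u) (<-≤-trans u≤j′ 1+p≤E)) nf)

  Anchored-new : ∀ {j′ R c b E} → Row c → NotFirst (suc j′) c → HeadOK j′ R c b E → BoundaryFree c (b , E) →
                 endsIn b j′ (R (φ (suc j′) c)) < d →
                 endsIn b (suc j′) (R (φ (suc j′) c)) ≡ d →
                 Anchored R c (b , suc j′)
  Anchored-new {j′} {R} {c} {b} c-row nf hd free before now =
    constant , endsIn-suc-new b j′ _ (subst (endsIn b j′ (R (φ (suc j′) c)) <_) (sym now) before)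
    where
    open HeadOK hd
    constant : ∀ t → b ≤ t → t ≤ suc j′ → NotFirst t c × φ t c ≡ φ (suc j′) c
    constant t b≤t t≤j = subst (λ j → NotFirst t c × φ t c ≡ φ j c) j∸t+t≡j
      (φ-constant (suc j′ ∸ t) c-row (≤-trans 1≤b b≤t)
        (λ u t≤u u< → free u (≤-trans b≤t t≤u) (<-≤-trans (subst (u <_) j∸t+t≡j u<) 1+p≤E))
        (subst (λ j → NotFirst j c) (sym j∸t+t≡j) nf))
      where
      j∸t+t≡j = m∸n+n≡m t≤j

  step-passive : ∀ j′ k {L R b rest} → k < h → Inv (suc j′) (suc k) (L , R) →
                 let c = PA (suc j′) (suc k) in RowInv j′ ((b , suc j′) ∷ rest) R c →
                 Inv (suc j′) (suc (suc k)) (update L c rest , extend R c ((b , suc j′) , false))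
  step-passive j′ k {rest = rest} k<h inv
               inv-c@record { contiguous = _ , starts , contiguous′ ; free = _ ∷ free′ } =
    Inv-extend (suc j′) k _ rest (s≤s z≤n) k<h refl inv
      (RowInv-cut false rest inv-c starts contiguous′ free′ λ ())

  step-active : 0 < d → ∀ j′ k {L R b E rest} → k < h → Inv (suc j′) (suc k) (L , R) →
                let j = suc j′ ; c = PA j (suc k) in
                RowInv j′ ((b , E) ∷ rest) R c → j ≢ E →
                ((1 <ᵇ suc k) ∧ (countOverlap (b , j) (R (PA j k)) ≡ᵇ d)) ≡ true →
                Inv j (suc (suc k)) (update L c ((suc j , E) ∷ rest) , extend R c ((b , j) , true))
  step-active 0<d j′ zero    k<h inv inv-c j≢E ()
  step-active 0<d j′ (suc k) {L} {R} {b} {E} {rest} k<h inv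
              inv-c@record { contiguous = _ , starts , contiguous′ ; free = free-b ∷ free′ ; head = hd } j≢E active =
    Inv-extend j (suc k) _ _ (s≤s z≤n) k<h refl inv
      (RowInv-cut true ((suc j , E) ∷ rest) inv-c refl (1+j≤E , starts , contiguous′) (free-after ∷ free′)
        (λ _ → Anchored-mono c _ (⊑-extend R c _) anchored))
    where
    open HeadOK hd
    j = suc j′
    c = PA j (suc (suc k))
    1+j≤E : suc j ≤ E
    1+j≤E = ≤∧≢⇒< 1+p≤E j≢E
    free-after : BoundaryFree c (suc j , E)
    free-after u j<u = free-b u (≤-trans b≤1+p (<⇒≤ j<u))
    c-row = PA-Row j k<h
    nf : NotFirst j c
    nf = k , pos-PA j k<h
    count≡ : endsIn b j (R (φ j c)) ≡ d
    count≡ = begin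
      endsIn b j (R (φ j c))                  ≡⟨ cong (λ x → endsIn b j (R x)) (φ-PA j (pos-PA j k<h)) ⟩
      endsIn b j (R (PA j (suc k)))           ≡⟨ countOverlap-previous j k k<h inv b≤1+p ⟨
      countOverlap (b , j) (R (PA j (suc k))) ≡⟨ ≡ᵇ⇒≡ _ d (subst T (sym active) tt) ⟩
      d                                       ∎
      where open ≡-Reasoning
    anchored : Anchored R c (b , j)
    anchored = Anchored-new c-row nf hd free-b (few-ends-before 0<d c-row nf hd free-b) count≡

  few-ends-idle : 0 < d → ∀ j′ k {L R b E} → k < h → Inv (suc j′) (suc k) (L , R) →
                  let j = suc j′ ; c = PA j (suc k) in
                  HeadOK j′ R c b E → BoundaryFree c (b , E) →
                  ((1 <ᵇ suc k) ∧ (countOverlap (b , j) (R (PA j k)) ≡ᵇ d)) ≡ false →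
                  b ≤ j → endsIn b j (R (φ j c)) < d
  few-ends-idle 0<d j′ zero {R = R} k<h (_ , others) _ _ _ _
    rewrite φ-first (suc j′) (pos-PA (suc j′) k<h) | others 0 (λ { (() , _) }) = 0<d
  few-ends-idle 0<d j′ (suc k) {L} {R} {b} k<h inv hd free-b idle b≤j =
    ≤∧≢⇒< (≤-trans (endsIn-suc-≤ b j′ chain′) (few-ends-before 0<d c-row nf hd free-b)) ends≢d
    where
    j = suc j′
    c = PA j (suc (suc k))
    c-row = PA-Row j k<h
    nf : NotFirst j c
    nf = k , pos-PA j k<h
    φ≡ : φ j c ≡ PA j (suc k)
    φ≡ = φ-PA j (pos-PA j k<h)
    chain′ : Chain (R (φ j c))
    chain′ = subst (Chain ∘ R) (sym φ≡) (RowInv.chain (Inv-previous j k k<h inv))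
    ends≢d : endsIn b j (R (φ j c)) ≢ d
    ends≢d ends≡d = subst T idle (≡⇒≡ᵇ _ d (begin
      countOverlap (b , j) (R (PA j (suc k))) ≡⟨ countOverlap-previous j k k<h inv b≤j ⟩
      endsIn b j (R (PA j (suc k)))           ≡⟨ cong (λ x → endsIn b j (R x)) φ≡ ⟨
      endsIn b j (R (φ j c))                  ≡⟨ ends≡d ⟩
      d                                       ∎))
      where open ≡-Reasoning

  step-idle : 0 < d → ∀ j′ k {L R b E rest} → k < h → Inv (suc j′) (suc k) (L , R) →
              let j = suc j′ ; c = PA j (suc k) in
              L c ≡ (b , E) ∷ rest → RowInv j′ ((b , E) ∷ rest) R c → j ≢ E →
              ((1 <ᵇ suc k) ∧ (countOverlap (b , j) (R (PA j k)) ≡ᵇ d)) ≡ false →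
              Inv j (suc (suc k)) (L , R)
  step-idle 0<d j′ k {L} {R} k<h inv Lc≡ inv-c@record { free = free-b ∷ _ ; head = hd } j≢E idle =
    Inv-idle (suc j′) k k<h inv (subst (λ l → RowInv (suc j′) l R (PA (suc j′) (suc k))) (sym Lc≡)
      (RowInv-advance inv-c (HeadOK-advance hd j≢E (few-ends-idle 0<d j′ k k<h inv hd free-b idle))))

  step-preserves : 0 < d → ∀ j′ k {st} → k < h → Inv (suc j′) (suc k) st →
                   Inv (suc j′) (suc (suc k)) (step (suc j′) (suc k) st)
  step-preserves 0<d j′ k {L , R} k<h inv
    with L (PA (suc j′) (suc k)) in Lc≡ | Inv-current (suc j′) k k<h inv
  ... | [] | inv-c = Inv-idle (suc j′) k k<h inv
    (subst (λ l → RowInv (suc j′) l R (PA (suc j′) (suc k))) (sym Lc≡) (RowInv-advance inv-c tt))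
  ... | (b , E) ∷ rest | inv-c with suc j′ ≡ᵇ E | ≡ᵇ-reflects-≡ (suc j′) E
  ...   | true  | ofʸ refl = step-passive j′ k k<h inv inv-c
  ...   | false | ofⁿ j≢E with (1 <ᵇ suc k) ∧ (countOverlap (b , suc j′) (R (PA (suc j′) k)) ≡ᵇ d) in active
  ...     | true  = step-active 0<d j′ k k<h inv inv-c j≢E active
  ...     | false = step-idle 0<d j′ k k<h inv Lc≡ inv-c j≢E active

  Inv-init : Inv 1 1 initState
  Inv-init =
    (λ c c-row → subst (λ p → RowInv p (hapIntervals c) (λ _ → []) c) (sym (lastCol-start 0 c-row)) (initial c))
    , λ _ _ → refl
    where
    initial : ∀ c → RowInv 0 (hapIntervals c) (λ _ → []) c
    initial c with starts , contiguous , free ← hapIntervals-wellFormed c = record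
      { chain = [] , [] ; ends≤ = [] ; contiguous = contiguous ; free = free
      ; head = HeadInv-fresh _ starts contiguous [] ; anchored = [] }

  Inv-nextColumn : ∀ j {st} → Inv j (suc h) st → Inv (suc j) 1 st
  Inv-nextColumn j {L , R} (rows , others) =
    (λ c c-row → subst (λ p → RowInv p (L c) R c) (trans (lastCol-end j c-row) (sym (lastCol-start j c-row)))
                   (rows c c-row))
    , others

  column-preserves : 0 < d → ∀ j′ {st} → Inv (suc j′) 1 st →
                     Inv (suc j′) (suc h) (foldl (λ st′ i → step (suc j′) i st′) st (oneTo h))
  column-preserves 0<d j′ =
    foldl-range-induction (λ i → Inv (suc j′) i) (λ st i → step (suc j′) i st) 1 h step′
    where
    step′ : ∀ {i st} → 1 ≤ i → i < 1 + h → Inv (suc j′) i st → Inv (suc j′) (suc i) (step (suc j′) i st)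
    step′ {suc k} _ (s≤s k<h) = step-preserves 0<d j′ k k<h

  Inv-final : 0 < d → Inv (suc m) 1 finalState
  Inv-final 0<d = foldl-range-induction (λ j → Inv j 1) runColumn 1 m column Inv-init
    where
    runColumn : State → ℕ → State
    runColumn st j = foldl (λ st′ i → step j i st′) st (oneTo h)
    column : ∀ {j st} → 1 ≤ j → j < 1 + m → Inv j 1 st → Inv (suc j) 1 (runColumn st j)
    column {suc j′} _ _ inv = Inv-nextColumn (suc j′) (column-preserves 0<d j′ inv)

  RS-invariant : 0 < d → ∀ c → Chain (RS c) × All (λ y → proj₂ y ≡ true → Anchored RS c (proj₁ y)) (RS c)
  RS-invariant 0<d c with 1 ≤? c ×-dec c ≤? h
  ... | yes c-row = RowInv.chain inv , RowInv.anchored inv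
    where inv = proj₁ (Inv-final 0<d) c c-row
  ... | no ¬row rewrite proj₂ (Inv-final 0<d) c ¬row = ([] , []) , []

  relevant-end-covered : 0 < d → ∀ r s → Canonical s → Relevant r s →
                         let t = end (segOf r) in
                         start (segOf s) ≤ t × t ≤ end (segOf s) ×
                         NotFirst t (proj₁ s) × φ t (proj₁ s) ≡ proj₁ r
  relevant-end-covered 0<d (c′ , kr) (c , k) can (c′≡ , overlaps) =
    b≤e′ , e′≤e , nf , trans φ≡ (sym c′≡)
    where
    e = end (lookup (RS c) k)
    e′ = end (lookup (RS c′) kr)
    b′≤e = proj₁ (overlapᵇ⇒ (proj₁ (lookup (RS c′) kr)) (proj₁ (lookup (RS c) k)) overlaps)
    b≤e′ = proj₂ (overlapᵇ⇒ (proj₁ (lookup (RS c′) kr)) (proj₁ (lookup (RS c) k)) overlaps)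
    anchored = All.lookup (proj₂ (RS-invariant 0<d c)) (∈-lookup k) can
    constant = proj₁ anchored
    ends-at-e : Any (λ y → end y ≡ e) (RS c′)
    ends-at-e = subst (λ x → Any (λ y → end y ≡ e) (RS x)) (sym c′≡) (proj₂ anchored)
    e′≤e : e′ ≤ e
    e′≤e = subst (e′ ≤_) (lookup-index ends-at-e)
             (Chain-end-≤ (proj₁ (RS-invariant 0<d c′)) kr (Any.index ends-at-e)
               (subst (start (lookup (RS c′) kr) ≤_) (sym (lookup-index ends-at-e)) b′≤e))
    nf = proj₁ (constant e′ b≤e′ e′≤e)
    φ≡ = proj₂ (constant e′ b≤e′ e′≤e)

  relevant-unique : 0 < d → ∀ r s₁ s₂ → Canonical s₁ → Canonical s₂ →
                    Relevant r s₁ → Relevant r s₂ → s₁ ≡ s₂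
  relevant-unique 0<d r (c₁ , k₁) (c₂ , k₂) can₁ can₂ rel₁ rel₂
    with b₁≤t , t≤e₁ , nf₁ , φ₁≡ ← relevant-end-covered 0<d r (c₁ , k₁) can₁ rel₁
    with b₂≤t , t≤e₂ , nf₂ , φ₂≡ ← relevant-end-covered 0<d r (c₂ , k₂) can₂ rel₂
    with refl ← φ-injective _ nf₁ nf₂ (trans φ₁≡ (sym φ₂≡))
    = cong (c₁ ,_) (Chain-overlap⇒≡ (proj₁ (RS-invariant 0<d c₁)) k₁ k₂
                      (≤-trans b₁≤t t≤e₂) (≤-trans b₂≤t t≤e₁))

lemma11 : (h m d : ℕ) (S : ℕ → ℕ → ℕ) → 1 < d →
    (r s₁ s₂ : PBWT.RefinedSegment h m d S) →
    PBWT.Canonical h m d S s₁ → PBWT.Canonical h m d S s₂ →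
    PBWT.Relevant h m d S r s₁ → PBWT.Relevant h m d S r s₂ →
    s₁ ≡ s₂
lemma11 h m d S 1<d = Decomposition.relevant-unique h m d S (<-trans z<s 1<d)
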